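{- Let $k\geq 3$ be an integer. If $G \in \mathcal{G}_k$ is a graph of size $m$ (i.e. with $m$ edges), then $\iota(G,C_k)=\frac{m+1}{k+2}$.
   Context: All graphs are finite and simple. $C_k$ denotes the cycle of length $k$. For a graph $G$ and $D\subseteq V(G)$, $N[D]$ is the closed neighbourhood of $D$, and $G-N[D]$ is the subgraph induced by $V(G)\setminus N[D]$. A set $D\subseteq V(G)$ is a $C_k$-isolating set of $G$ if $G-N[D]$ contains no subgraph isomorphic to $C_k$; $\iota(G,C_k)$ is the minimum cardinality of a $C_k$-isolating set of $G$. For a tree $T$, ${\rm cons}(T,C_k)$ is the graph obtained from $T$ and $|V(T)|$ pairwise vertex-disjoint copies of $C_k$ (also disjoint from $T$), one for each vertex of $T$, by joining each vertex of $T$ by a single edge to one vertex of its own copy of $C_k$. $\mathcal{G}_k=\{{\rm cons}(T,C_k): T \text{ is a tree}\}$. -}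

module Defs where

open import Data.Nat using (ℕ; _+_; _*_; _≤_; _<_; _≡ᵇ_; _<ᵇ_)
open import Data.Nat.DivMod using (_mod_)
open import Data.Fin using (Fin; toℕ; remQuot; zero; suc)
open import Data.Fin.Subset using (Subset; _∈_; _∉_; ∣_∣)
open import Data.Bool using (Bool; true; false; _∧_; _∨_; if_then_else_)
open import Data.List using (List; map; allFin)
open import Data.Nat.ListAction using (sum)
open import Data.Unit using (⊤)
import Data.Nat as ℕ
open import Data.Product using (Σ; _×_; _,_; ∃)
open import Data.Sum using (_⊎_)
open import Relation.Nullary using (¬_)
open import Relation.Binary.PropositionalEquality using (_≡_)
open import Function.Definitions using (Injective)

record Graph : Set where
  field
    n   : ℕ
    adj : Fin n → Fin n → Bool
open Graph public

IsSimple : Graph → Set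
IsSimple G = (∀ u v → adj G u v ≡ adj G v u) × (∀ v → adj G v v ≡ false)

size : Graph → ℕ
size G = sum (map (λ u → sum (map (λ v →
           if (toℕ u <ᵇ toℕ v) ∧ adj G u v then 1 else 0) (allFin (n G)))) (allFin (n G)))

next : ∀ {k} → Fin k → Fin k
next {ℕ.suc k} i = ℕ.suc (toℕ i) mod ℕ.suc k

-- a subgraph isomorphic to C_k whose vertices all satisfy the predicate P
-- (an injective map f : Fin k → V with f i ~ f (i+1 mod k) for all i)
CycleIn : (G : Graph) → (k : ℕ) → (P : Fin (n G) → Set) → Set
CycleIn G k P = Σ (Fin k → Fin (n G)) λ f →
  Injective _≡_ _≡_ f × (∀ i → P (f i)) × (∀ i → adj G (f i) (f (next i)) ≡ true)

InClosedNbhd : (G : Graph) → Subset (n G) → Fin (n G) → Set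
InClosedNbhd G D v = v ∈ D ⊎ Σ (Fin (n G)) λ u → u ∈ D × adj G u v ≡ true

-- D is C_k-isolating: G - N[D] contains no subgraph isomorphic to C_k
IsCkIsolating : (G : Graph) → ℕ → Subset (n G) → Set
IsCkIsolating G k D = ¬ CycleIn G k (λ v → ¬ InClosedNbhd G D v)

IotaIs : (G : Graph) → ℕ → ℕ → Set
IotaIs G k c = (Σ (Subset (n G)) λ D → IsCkIsolating G k D × ∣ D ∣ ≡ c)
             × (∀ D → IsCkIsolating G k D → c ≤ ∣ D ∣)

data Reach (G : Graph) : Fin (n G) → Fin (n G) → Set where
  here : ∀ {v} → Reach G v v
  step : ∀ {u w v} → adj G u w ≡ true → Reach G w v → Reach G u v

IsTree : Graph → Set
IsTree T = IsSimple T × 1 ≤ n T × (∀ u v → Reach T u v)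
         × (∀ j → 3 ≤ j → ¬ CycleIn T j (λ _ → ⊤))

-- cons(T, C_k): vertex (i , zero) is tree vertex i, vertex (i , suc a) is
-- vertex a of the copy of C_k attached to i; i is joined to vertex 0 of its copy.
consBase : (T : Graph) (k : ℕ) → Fin (n T) × Fin (ℕ.suc k) → Fin (n T) × Fin (ℕ.suc k) → Bool
consBase T k (i , zero)  (i' , zero)  = adj T i i'
consBase T k (i , zero)  (i' , suc b) = (toℕ i ≡ᵇ toℕ i') ∧ (toℕ b ≡ᵇ 0)
consBase T k (i , suc a) (i' , suc b) = (toℕ i ≡ᵇ toℕ i') ∧ (toℕ b ≡ᵇ toℕ (next a))
consBase T k (i , suc a) (i' , zero)  = false

cons : Graph → ℕ → Graph
cons T k = record
  { n   = n T * ℕ.suc k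
  ; adj = λ u v → consBase T k (remQuot (ℕ.suc k) u) (remQuot (ℕ.suc k) v)
                ∨ consBase T k (remQuot (ℕ.suc k) v) (remQuot (ℕ.suc k) u)
  }

InGk : ℕ → Graph → Set
InGk k G = Σ Graph λ T → IsTree T × G ≡ cons T k

-- With N tree vertices, G = cons(T, C_k) splits into N blocks: a tree vertex together with its
-- attached k-cycle. Every C_k-isolating set D meets every block, for otherwise the attached cycle
-- avoids N[D]; so ι(G, C_k) ≥ N. The N tree vertices form a C_k-isolating set: outside their
-- closed neighbourhood only positions 2, …, k of each cycle survive, and a cycle avoiding N[D]
-- cannot leave a block, so it would be an injective k-cycle on k − 1 vertices. Hence ι(G, C_k) = N.
-- Counting degrees, 2|E(G)| = 2|E(T)| + N(2k + 2), and a tree has N − 1 edges (delete the leaf at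
-- the end of a maximal path and induct), so |E(G)| + 1 = N(k + 2).

module Submission where

open import Defs
open import Data.Bool using (Bool; true; false; _∧_; _∨_; if_then_else_)
import Data.Bool as Bool
import Data.Bool.Properties as Boolₚ
open import Data.Empty using (⊥-elim)
open import Data.Fin using (Fin; zero; suc; toℕ; fromℕ; fromℕ<; inject₁; punchIn; punchOut; combine; remQuot; _↑ˡ_; _↑ʳ_)
import Data.Fin.Properties as Finₚ
open import Data.Fin.Induction using (<-weakInduction)
open import Data.Fin.Relation.Unary.Top using (view; ‵fromℕ; ‵inj₁)
open import Data.Fin.Subset using (Subset; _∈_; ∣_∣)
open import Data.List using (map; allFin; tabulate)
import Data.List.Properties as Listₚ
import Data.Nat.ListAction as List
open import Data.Nat using (ℕ; zero; suc; _+_; _*_; _≤_; _<_; _≡ᵇ_; _<ᵇ_; z≤n; s≤s)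
import Data.Nat.Properties as ℕₚ
open import Algebra.Properties.CommutativeMonoid.Sum ℕₚ.+-0-commutativeMonoid
  using (sum; sum-cong-≗; ∑-comm; ∑-distrib-+; sum-remove)
open import Algebra.Properties.Semiring.Sum ℕₚ.+-*-semiring using (*-distribʳ-sum)
open import Data.Nat.Tactic.RingSolver using (solve-∀)
open import Data.Nat.DivMod using (_%_; m<n⇒m%n≡m; n%n≡0)
open import Data.Product using (Σ; ∃; _×_; _,_; proj₁; proj₂)
open import Data.Sum using (inj₁; inj₂)
open import Data.Unit using (⊤; tt)
open import Data.Vec using ([]; _∷_; lookup)
import Data.Vec as Vec
import Data.Vec.Properties as Vecₚ
open import Function using (_∘_; Equivalence)
open import Function.Definitions using (Injective)
open import Relation.Binary.Definitions using (tri<; tri≈; tri>)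
open import Relation.Binary.PropositionalEquality
open import Relation.Nullary using (¬_; Dec; yes; no; does)
open import Relation.Nullary.Decidable using (dec-true; dec-false; _×-dec_; ¬?)

⟦_⟧ : Bool → ℕ
⟦ b ⟧ = if b then 1 else 0

≡ᵇ-does : ∀ {m} (i j : Fin m) → (toℕ i ≡ᵇ toℕ j) ≡ does (i Finₚ.≟ j)
≡ᵇ-does i j with i Finₚ.≟ j
... | yes refl = Equivalence.to Boolₚ.T-≡ (ℕₚ.≡⇒≡ᵇ (toℕ i) (toℕ i) refl)
... | no i≢j   = Boolₚ.¬-not (i≢j ∘ Finₚ.toℕ-injective ∘ ℕₚ.≡ᵇ⇒≡ _ _ ∘ Equivalence.from Boolₚ.T-≡)

≡ᵇ-refl : ∀ {m} (i : Fin m) → (toℕ i ≡ᵇ toℕ i) ≡ true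
≡ᵇ-refl i = trans (≡ᵇ-does i i) (dec-true (i Finₚ.≟ i) refl)

≡ᵇ-≢ : ∀ {m} {i j : Fin m} → i ≢ j → (toℕ i ≡ᵇ toℕ j) ≡ false
≡ᵇ-≢ {i = i} {j} i≢j = trans (≡ᵇ-does i j) (dec-false (i Finₚ.≟ j) i≢j)

T-≡ᵇ⇒≡ : ∀ {m} {i j : Fin m} → Bool.T (toℕ i ≡ᵇ toℕ j) → i ≡ j
T-≡ᵇ⇒≡ = Finₚ.toℕ-injective ∘ ℕₚ.≡ᵇ⇒≡ _ _

⟦∨⟧≡+ : ∀ {x y} → ¬ (Bool.T x × Bool.T y) → ⟦ x ∨ y ⟧ ≡ ⟦ x ⟧ + ⟦ y ⟧
⟦∨⟧≡+ {true}  {true}  ¬both = ⊥-elim (¬both (tt , tt))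
⟦∨⟧≡+ {true}  {false} _     = refl
⟦∨⟧≡+ {false}         _     = refl

<ᵇ-true : ∀ {m n} → m < n → (m <ᵇ n) ≡ true
<ᵇ-true m<n = Equivalence.to Boolₚ.T-≡ (ℕₚ.<⇒<ᵇ m<n)

<ᵇ-false : ∀ {m n} → ¬ m < n → (m <ᵇ n) ≡ false
<ᵇ-false {m} {n} m≮n = Boolₚ.¬-not (m≮n ∘ ℕₚ.<ᵇ⇒< m n ∘ Equivalence.from Boolₚ.T-≡)

sum-zero : ∀ {n} (f : Fin n → ℕ) → (∀ i → f i ≡ 0) → sum f ≡ 0
sum-zero {zero}  f f≡0 = refl
sum-zero {suc n} f f≡0 = cong₂ _+_ (f≡0 zero) (sum-zero (f ∘ suc) (f≡0 ∘ suc))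

sum-const : ∀ n c → sum {n} (λ _ → c) ≡ n * c
sum-const zero    c = refl
sum-const (suc n) c = cong (c +_) (sum-const n c)

sum-ones : ∀ n → sum {n} (λ _ → 1) ≡ n
sum-ones zero    = refl
sum-ones (suc n) = cong suc (sum-ones n)

sum-mono : ∀ {n} {f g : Fin n → ℕ} → (∀ i → f i ≤ g i) → sum f ≤ sum g
sum-mono {zero}  f≤g = z≤n
sum-mono {suc n} f≤g = ℕₚ.+-mono-≤ (f≤g zero) (sum-mono (f≤g ∘ suc))

term≤sum : ∀ {n} (f : Fin n → ℕ) i → f i ≤ sum f
term≤sum f zero    = ℕₚ.m≤m+n (f zero) _
term≤sum f (suc i) = ℕₚ.≤-trans (term≤sum (f ∘ suc) i) (ℕₚ.m≤n+m _ (f zero))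

sum-↑ : ∀ a b (f : Fin (a + b) → ℕ) → sum f ≡ sum (λ i → f (i ↑ˡ b)) + sum (λ j → f (a ↑ʳ j))
sum-↑ zero    b f = refl
sum-↑ (suc a) b f = trans (cong (f zero +_) (sum-↑ a b (f ∘ suc))) (sym (ℕₚ.+-assoc (f zero) _ _))

sum-combine : ∀ m n (f : Fin (m * n) → ℕ) → sum f ≡ sum {m} λ i → sum {n} λ j → f (combine i j)
sum-combine zero    n f = refl
sum-combine (suc m) n f =
  trans (sum-↑ n (m * n) f) (cong (sum (λ j → f (j ↑ˡ m * n)) +_) (sum-combine m n (f ∘ (n ↑ʳ_))))

sum-≟ : ∀ {n} (i : Fin n) → sum {n} (λ j → ⟦ does (j Finₚ.≟ i) ⟧) ≡ 1
sum-≟ {suc n} i = trans (sum-remove {i = i} (λ j → ⟦ does (j Finₚ.≟ i) ⟧)) (cong₂ _+_ at-i off-i)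
  where
  at-i : ⟦ does (i Finₚ.≟ i) ⟧ ≡ 1
  at-i = cong ⟦_⟧ (dec-true (i Finₚ.≟ i) refl)
  off-i : sum (λ j → ⟦ does (punchIn i j Finₚ.≟ i) ⟧) ≡ 0
  off-i = sum-zero _ λ j → cong ⟦_⟧ (dec-false (punchIn i j Finₚ.≟ i) (Finₚ.punchInᵢ≢i i j))

sum-≡ᵇ : ∀ {n} (i : Fin n) → sum {n} (λ j → ⟦ toℕ j ≡ᵇ toℕ i ⟧) ≡ 1
sum-≡ᵇ {n} i = trans (sum-cong-≗ {n} does-form) (sum-≟ i)
  where
  does-form : ∀ j → ⟦ toℕ j ≡ᵇ toℕ i ⟧ ≡ ⟦ does (j Finₚ.≟ i) ⟧
  does-form j = cong ⟦_⟧ (≡ᵇ-does j i)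

sum-graph : ∀ {n} (f : Fin n → Fin n) → sum {n} (λ i → sum {n} λ j → ⟦ toℕ j ≡ᵇ toℕ (f i) ⟧) ≡ n
sum-graph {n} f = trans (sum-cong-≗ {n} λ i → sum-≡ᵇ (f i)) (sum-ones n)

sum₂-split : ∀ {k} (H : Fin (suc k) → Fin (suc k) → ℕ) →
  sum (λ a → sum (H a)) ≡
  (H zero zero + sum (H zero ∘ suc)) + (sum (λ a → H (suc a) zero) + sum (λ a → sum (H (suc a) ∘ suc)))
sum₂-split {k} H =
  cong (H zero zero + sum (H zero ∘ suc) +_) (∑-distrib-+ {k} (λ a → H (suc a) zero) (λ a → sum (H (suc a) ∘ suc)))

sum-allFin : ∀ n (f : Fin n → ℕ) → List.sum (map f (allFin n)) ≡ sum f
sum-allFin n f = trans (cong List.sum (Listₚ.map-tabulate (λ i → i) f)) (sum-tabulate n f)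
  where
  sum-tabulate : ∀ n (f : Fin n → ℕ) → List.sum (tabulate f) ≡ sum f
  sum-tabulate zero    f = refl
  sum-tabulate (suc n) f = cong (f zero +_) (sum-tabulate n (f ∘ suc))

∣p∣≡sum : ∀ {n} (p : Subset n) → ∣ p ∣ ≡ sum (⟦_⟧ ∘ lookup p)
∣p∣≡sum []          = refl
∣p∣≡sum (true ∷ p)  = cong suc (∣p∣≡sum p)
∣p∣≡sum (false ∷ p) = ∣p∣≡sum p

degree : (G : Graph) → Fin (n G) → ℕ
degree G u = sum λ v → ⟦ adj G u v ⟧

degreeSum : Graph → ℕ
degreeSum G = sum (degree G)

module _ (G : Graph) where

  private
    forward : Fin (n G) → Fin (n G) → ℕ
    forward u v = ⟦ (toℕ u <ᵇ toℕ v) ∧ adj G u v ⟧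

  size≡∑forward : size G ≡ sum λ u → sum λ v → forward u v
  size≡∑forward = trans (sum-allFin (n G) _) (sum-cong-≗ {n G} λ u → sum-allFin (n G) _)

  adj≡forward+backward : IsSimple G → ∀ u v → ⟦ adj G u v ⟧ ≡ forward u v + forward v u
  adj≡forward+backward (symmetric , irreflexive) u v with ℕₚ.<-cmp (toℕ u) (toℕ v)
  ... | tri< u<v _ v≮u
    rewrite <ᵇ-true u<v | <ᵇ-false v≮u = sym (ℕₚ.+-identityʳ _)
  ... | tri> u≮v _ v<u
    rewrite <ᵇ-true v<u | <ᵇ-false u≮v | symmetric v u = refl
  ... | tri≈ u≮v u≡v _
    rewrite Finₚ.toℕ-injective u≡v | irreflexive v | <ᵇ-false u≮v = refl

  handshake : IsSimple G → 2 * size G ≡ degreeSum G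
  handshake simple = begin
    2 * size G
      ≡⟨ cong (size G +_) (ℕₚ.+-identityʳ (size G)) ⟩
    size G + size G
      ≡⟨ cong₂ _+_ size≡∑forward (trans size≡∑forward (∑-comm forward)) ⟩
    sum (λ u → sum λ v → forward u v) + sum (λ u → sum λ v → forward v u)
      ≡⟨ sym (∑-distrib-+ {n G} _ _) ⟩
    sum (λ u → sum (λ v → forward u v) + sum λ v → forward v u)
      ≡⟨ sum-cong-≗ {n G} (λ u → sym (∑-distrib-+ {n G} _ _)) ⟩
    sum (λ u → sum λ v → forward u v + forward v u)
      ≡⟨ sum-cong-≗ {n G} (λ u → sum-cong-≗ {n G} λ v → sym (adj≡forward+backward simple u v)) ⟩
    degreeSum G
      ∎
    where open ≡-Reasoning

next-inject₁ : ∀ {m} (i : Fin m) → next (inject₁ i) ≡ suc i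
next-inject₁ {m} i = Finₚ.toℕ-injective (begin
  toℕ (next (inject₁ i))   ≡⟨ Finₚ.toℕ-fromℕ< _ ⟩
  suc (toℕ (inject₁ i)) % suc m ≡⟨ cong (λ t → suc t % suc m) (Finₚ.toℕ-inject₁ i) ⟩
  suc (toℕ i) % suc m      ≡⟨ m<n⇒m%n≡m (s≤s (Finₚ.toℕ<n i)) ⟩
  suc (toℕ i)              ∎)
  where open ≡-Reasoning

next-fromℕ : ∀ m → next (fromℕ m) ≡ zero
next-fromℕ m = Finₚ.toℕ-injective (begin
  toℕ (next (fromℕ m))     ≡⟨ Finₚ.toℕ-fromℕ< _ ⟩
  suc (toℕ (fromℕ m)) % suc m ≡⟨ cong (λ t → suc t % suc m) (Finₚ.toℕ-fromℕ m) ⟩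
  suc m % suc m            ≡⟨ n%n≡0 (suc m) ⟩
  0                        ∎)
  where open ≡-Reasoning

next-invariant⇒constant : ∀ {m} {A : Set} (f : Fin (suc m) → A) →
  (∀ i → f (next i) ≡ f i) → ∀ i → f i ≡ f zero
next-invariant⇒constant f invariant = <-weakInduction (λ i → f _ ≡ f zero) refl
  λ i fi≡f0 → trans (cong f (sym (next-inject₁ i))) (trans (invariant (inject₁ i)) fi≡f0)

next≢id : ∀ {m} (i : Fin (suc (suc m))) → next i ≢ i
next≢id {m} i with view i
... | ‵fromℕ rewrite next-fromℕ (suc m) = λ ()
... | ‵inj₁ {i = j} _ rewrite next-inject₁ j =
  λ sj≡j → ℕₚ.1+n≢n (trans (cong toℕ sj≡j) (Finₚ.toℕ-inject₁ j))

next∘next≢id : ∀ {m} (i : Fin (suc (suc (suc m)))) → next (next i) ≢ i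
next∘next≢id {m} i with view i
... | ‵fromℕ rewrite next-fromℕ (suc (suc m)) = λ ()
... | ‵inj₁ {i = j} _ rewrite next-inject₁ j with view j
...   | ‵fromℕ rewrite next-fromℕ (suc (suc m)) = λ ()
...   | ‵inj₁ {i = l} _ rewrite next-inject₁ (suc l) =
  λ ssl≡l → ℕₚ.m≢1+n+m (toℕ l)
    (sym (trans (cong toℕ ssl≡l) (trans (Finₚ.toℕ-inject₁ (inject₁ l)) (Finₚ.toℕ-inject₁ l))))

cycle-degreeSum : ∀ {m} → let k = suc (suc (suc m)) in
  sum {k} (λ a → sum {k} λ b → ⟦ (toℕ b ≡ᵇ toℕ (next a)) ∨ (toℕ a ≡ᵇ toℕ (next b)) ⟧) ≡ k + k
cycle-degreeSum {m} = begin
  sum (λ a → sum λ b → ⟦ succ a b ∨ succ b a ⟧)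
    ≡⟨ sum-cong-≗ {k} (λ a → sum-cong-≗ {k} (split a)) ⟩
  sum (λ a → sum λ b → ⟦ succ a b ⟧ + ⟦ succ b a ⟧)
    ≡⟨ sum-cong-≗ {k} (λ a → ∑-distrib-+ {k} (λ b → ⟦ succ a b ⟧) (λ b → ⟦ succ b a ⟧)) ⟩
  sum (λ a → sum (λ b → ⟦ succ a b ⟧) + sum λ b → ⟦ succ b a ⟧)
    ≡⟨ ∑-distrib-+ {k} (λ a → sum λ b → ⟦ succ a b ⟧) (λ a → sum λ b → ⟦ succ b a ⟧) ⟩
  sum (λ a → sum λ b → ⟦ succ a b ⟧) + sum (λ a → sum λ b → ⟦ succ b a ⟧)
    ≡⟨ cong (sum (λ a → sum λ b → ⟦ succ a b ⟧) +_) (∑-comm {k} {k} λ a b → ⟦ succ b a ⟧) ⟩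
  sum (λ a → sum λ b → ⟦ succ a b ⟧) + sum (λ b → sum λ a → ⟦ succ b a ⟧)
    ≡⟨ cong₂ _+_ in-degrees in-degrees ⟩
  k + k
    ∎
  where
  open ≡-Reasoning
  k = suc (suc (suc m))
  succ : Fin k → Fin k → Bool
  succ a b = toℕ b ≡ᵇ toℕ (next a)
  in-degrees : sum (λ a → sum λ b → ⟦ succ a b ⟧) ≡ k
  in-degrees = sum-graph next
  -- b ≡ next a and a ≡ next b at once would make a 2-cycle, which k ≥ 3 rules out.
  split : ∀ a b → ⟦ succ a b ∨ succ b a ⟧ ≡ ⟦ succ a b ⟧ + ⟦ succ b a ⟧
  split a b = ⟦∨⟧≡+ {succ a b} {succ b a} λ (b≡a⁺ , a≡b⁺) →
    next∘next≢id a (trans (cong next (sym (T-≡ᵇ⇒≡ {i = b} b≡a⁺))) (sym (T-≡ᵇ⇒≡ {i = a} a≡b⁺)))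

IsLeaf : (G : Graph) → Fin (n G) → Fin (n G) → Set
IsLeaf G h q = adj G h q ≡ true × (∀ v → adj G h v ≡ true → v ≡ q)

Acyclic : Graph → Set
Acyclic G = ∀ j → 3 ≤ j → ¬ CycleIn G j (λ _ → ⊤)

module _ {G : Graph} (simple : IsSimple G) where

  private
    symmetric = proj₁ simple
    irreflexive = proj₂ simple

  adj⇒≢ : ∀ {u v} → adj G u v ≡ true → u ≢ v
  adj⇒≢ {u} uv refl = Boolₚ.not-¬ (irreflexive u) uv

  record Path : Set where
    field
      length : ℕ
      vertex : ℕ → Fin (n G)
      injective : ∀ {a b} → a ≤ length → b ≤ length → vertex a ≡ vertex b → a ≡ b
      adjacent : ∀ {a} → a < length → adj G (vertex a) (vertex (suc a)) ≡ true

  open Path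

  Maximal : Path → Set
  Maximal P = ∀ v → adj G (vertex P 0) v ≡ true → ∃ λ a → a ≤ length P × vertex P a ≡ v

  edge-path : ∀ {u v} → adj G u v ≡ true → Path
  edge-path {u} {v} uv = record { length = 1 ; vertex = vertex′ ; injective = injective′ ; adjacent = adjacent′ }
    where
    vertex′ : ℕ → Fin (n G)
    vertex′ zero    = u
    vertex′ (suc _) = v
    injective′ : ∀ {a b} → a ≤ 1 → b ≤ 1 → vertex′ a ≡ vertex′ b → a ≡ b
    injective′ {zero}  {zero}  _         _         _   = refl
    injective′ {zero}  {suc _} _         (s≤s z≤n) u≡v = ⊥-elim (adj⇒≢ uv u≡v)
    injective′ {suc _} {zero}  (s≤s z≤n) _         v≡u = ⊥-elim (adj⇒≢ uv (sym v≡u))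
    injective′ {suc _} {suc _} (s≤s z≤n) (s≤s z≤n) _   = refl
    adjacent′ : ∀ {a} → a < 1 → adj G (vertex′ a) (vertex′ (suc a)) ≡ true
    adjacent′ (s≤s z≤n) = uv

  length<n : (P : Path) → length P < n G
  length<n P = Finₚ.injective⇒≤ {f = λ (a : Fin (suc (length P))) → vertex P (toℕ a)}
    λ {a} {b} → Finₚ.toℕ-injective ∘ injective P (≤-of a) (≤-of b)
    where
    ≤-of : (a : Fin (suc (length P))) → toℕ a ≤ length P
    ≤-of a = ℕₚ.≤-pred (Finₚ.toℕ<n a)

  prepend : (P : Path) → ∀ {v} → adj G (vertex P 0) v ≡ true →
            (∀ {a} → a ≤ length P → vertex P a ≢ v) → Path
  prepend P {v} uv v∉P = record
    { length = suc (length P) ; vertex = vertex′ ; injective = injective′ ; adjacent = adjacent′ }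
    where
    vertex′ : ℕ → Fin (n G)
    vertex′ zero    = v
    vertex′ (suc a) = vertex P a
    injective′ : ∀ {a b} → a ≤ suc (length P) → b ≤ suc (length P) → vertex′ a ≡ vertex′ b → a ≡ b
    injective′ {zero}  {zero}  _  _  _  = refl
    injective′ {zero}  {suc b} _  b≤ eq = ⊥-elim (v∉P (ℕₚ.≤-pred b≤) (sym eq))
    injective′ {suc a} {zero}  a≤ _  eq = ⊥-elim (v∉P (ℕₚ.≤-pred a≤) eq)
    injective′ {suc a} {suc b} a≤ b≤ eq = cong suc (injective P (ℕₚ.≤-pred a≤) (ℕₚ.≤-pred b≤) eq)
    adjacent′ : ∀ {a} → a < suc (length P) → adj G (vertex′ a) (vertex′ (suc a)) ≡ true
    adjacent′ {zero}  _   = trans (symmetric v (vertex P 0)) uv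
    adjacent′ {suc a} a<l = adjacent P (ℕₚ.≤-pred a<l)

  private
    on? : (P : Path) (v : Fin (n G)) → Dec (∃ λ (a : Fin (suc (length P))) → vertex P (toℕ a) ≡ v)
    on? P v = Finₚ.any? λ a → vertex P (toℕ a) Finₚ.≟ v

    new-neighbour? : (P : Path) →
      Dec (∃ λ v → adj G (vertex P 0) v ≡ true × ¬ ∃ λ (a : Fin (suc (length P))) → vertex P (toℕ a) ≡ v)
    new-neighbour? P = Finₚ.any? λ v → (adj G (vertex P 0) v Boolₚ.≟ true) ×-dec ¬? (on? P v)

    extend : ∀ fuel (P : Path) → n G ≤ length P + fuel → Σ Path λ Q → Maximal Q × length P ≤ length Q
    extend fuel P bound with new-neighbour? P
    extend zero P bound | yes _ =
      ⊥-elim (ℕₚ.<⇒≱ (length<n P) (subst (n G ≤_) (ℕₚ.+-identityʳ (length P)) bound))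
    extend (suc fuel) P bound | yes (v , uv , v∉P) =
      let Q , maximal , P≤Q = extend fuel (prepend P uv v∉P′) (subst (n G ≤_) (ℕₚ.+-suc (length P) fuel) bound)
      in  Q , maximal , ℕₚ.≤-trans (ℕₚ.n≤1+n (length P)) P≤Q
      where
      v∉P′ : ∀ {a} → a ≤ length P → vertex P a ≢ v
      v∉P′ a≤l eq = v∉P (fromℕ< (s≤s a≤l) , trans (cong (vertex P) (Finₚ.toℕ-fromℕ< (s≤s a≤l))) eq)
    extend fuel P bound | no none = P , maximal , ℕₚ.≤-refl
      where
      maximal : Maximal P
      maximal v uv with on? P v
      ... | yes (a , eq) = toℕ a , ℕₚ.≤-pred (Finₚ.toℕ<n a) , eq
      ... | no v∉P      = ⊥-elim (none (v , uv , v∉P))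

  maximal-extension : (P : Path) → Σ Path λ Q → Maximal Q × length P ≤ length Q
  maximal-extension P = extend (n G) P (ℕₚ.m≤n+m (n G) (length P))

  closing-edge⇒cycle : (P : Path) → ∀ {a} → a ≤ length P → adj G (vertex P a) (vertex P 0) ≡ true →
                       CycleIn G (suc a) (λ _ → ⊤)
  closing-edge⇒cycle P {a} a≤l closing = f , f-injective , (λ _ → tt) , f-adjacent
    where
    f : Fin (suc a) → Fin (n G)
    f i = vertex P (toℕ i)
    f-injective : Injective _≡_ _≡_ f
    f-injective {i} {j} = Finₚ.toℕ-injective ∘ injective P (ℕₚ.≤-trans (ℕₚ.≤-pred (Finₚ.toℕ<n i)) a≤l)
                                                            (ℕₚ.≤-trans (ℕₚ.≤-pred (Finₚ.toℕ<n j)) a≤l)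
    f-adjacent : ∀ i → adj G (f i) (f (next i)) ≡ true
    f-adjacent i with view i
    ... | ‵fromℕ rewrite next-fromℕ a | Finₚ.toℕ-fromℕ a = closing
    ... | ‵inj₁ {i = j} _ rewrite next-inject₁ j | Finₚ.toℕ-inject₁ j =
      adjacent P (ℕₚ.<-≤-trans (Finₚ.toℕ<n j) a≤l)

  maximal⇒leaf : Acyclic G → (P : Path) → Maximal P → 1 ≤ length P → IsLeaf G (vertex P 0) (vertex P 1)
  maximal⇒leaf acyclic P maximal 1≤l = adjacent P 1≤l , only-neighbour
    where
    only-neighbour : ∀ v → adj G (vertex P 0) v ≡ true → v ≡ vertex P 1
    only-neighbour v uv with maximal v uv
    ... | zero        , _   , refl = ⊥-elim (adj⇒≢ uv refl)
    ... | suc zero    , _   , eq   = sym eq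
    ... | suc (suc a) , a≤l , refl =
      ⊥-elim (acyclic (3 + a) (s≤s (s≤s (s≤s z≤n))) (closing-edge⇒cycle P a≤l (trans (symmetric _ _) uv)))

reach⇒neighbour : ∀ {G u v} → Reach G u v → u ≢ v → ∃ λ w → adj G u w ≡ true
reach⇒neighbour here          u≢u = ⊥-elim (u≢u refl)
reach⇒neighbour (step uw _) _   = _ , uw

tree-leaf : ∀ {G} → IsTree G → ∀ {u v : Fin (n G)} → u ≢ v → ∃ λ h → ∃ λ q → IsLeaf G h q
tree-leaf (simple , _ , connected , acyclic) {u} {v} u≢v =
  let w , uw = reach⇒neighbour (connected u v) u≢v
      Q , maximal , 1≤l = maximal-extension simple (edge-path simple uw)
  in  _ , _ , maximal⇒leaf simple acyclic Q maximal 1≤l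

module LeafDeletion {N} (A : Fin (suc (suc N)) → Fin (suc (suc N)) → Bool) (h q : Fin (suc (suc N))) where

  G : Graph
  G = record { n = suc (suc N) ; adj = A }

  G-h : Graph
  G-h = record { n = suc N ; adj = λ u v → A (punchIn h u) (punchIn h v) }

  module _ (simple : IsSimple G) (leaf : IsLeaf G h q) where

    private
      symmetric = proj₁ simple

    reach-G-h : ∀ {x y} → Reach G x y → ∀ u v → x ≡ punchIn h u → y ≡ punchIn h v → Reach G-h u v
    reach-G-h here u v x≡u y≡v = subst (Reach G-h u) (Finₚ.punchIn-injective h u v (trans (sym x≡u) y≡v)) here
    reach-G-h (step {w = w} xw w→y) u v x≡u y≡v with h Finₚ.≟ w
    ... | no h≢w =
      step (trans (cong₂ A (sym x≡u) (Finₚ.punchIn-punchOut h≢w)) xw)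
           (reach-G-h w→y (punchOut h≢w) v (sym (Finₚ.punchIn-punchOut h≢w)) y≡v)
    ... | yes refl with w→y
    ...   | here = ⊥-elim (Finₚ.punchInᵢ≢i h v (sym y≡v))
    -- The walk enters and leaves the leaf h through q, so the detour x → h → w′ can be cut (x ≡ q ≡ w′).
    ...   | step {w = w′} hw′ w′→y =
      reach-G-h w′→y u v (trans (proj₂ leaf w′ hw′) (trans (sym (proj₂ leaf _ (trans (symmetric h _) xw))) x≡u)) y≡v

    tree-G-h : IsTree G → IsTree G-h
    tree-G-h (_ , _ , connected , acyclic) =
      ((λ u v → symmetric (punchIn h u) (punchIn h v)) , proj₂ simple ∘ punchIn h) , s≤s z≤n ,
      (λ u v → reach-G-h (connected (punchIn h u) (punchIn h v)) u v refl refl) ,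
      λ { j 3≤j (f , f-injective , _ , f-adjacent) →
          acyclic j 3≤j (punchIn h ∘ f , f-injective ∘ Finₚ.punchIn-injective h _ _ , (λ _ → tt) , f-adjacent) }

    degree-leaf : degree G h ≡ 1
    degree-leaf = trans (sum-cong-≗ {suc (suc N)} adj≡≟) (sum-≟ q)
      where
      adj≡≟ : ∀ v → ⟦ A h v ⟧ ≡ ⟦ does (v Finₚ.≟ q) ⟧
      adj≡≟ v with v Finₚ.≟ q | A h v in hv
      ... | yes refl | _     = cong ⟦_⟧ (trans (sym hv) (proj₁ leaf))
      ... | no v≢q   | true  = ⊥-elim (v≢q (proj₂ leaf v hv))
      ... | no _     | false = refl

    degreeSum-delete-leaf : degreeSum G ≡ 2 + degreeSum G-h
    degreeSum-delete-leaf = begin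
      degreeSum G
        ≡⟨ sum-remove {i = h} (degree G) ⟩
      degree G h + sum (λ u → degree G (punchIn h u))
        ≡⟨ cong₂ _+_ degree-leaf (sum-cong-≗ {suc N} λ u → sum-remove {i = h} (λ v → ⟦ A (punchIn h u) v ⟧)) ⟩
      1 + sum (λ u → ⟦ A (punchIn h u) h ⟧ + degree G-h u)
        ≡⟨ cong (1 +_) (∑-distrib-+ {suc N} (λ u → ⟦ A (punchIn h u) h ⟧) (degree G-h)) ⟩
      1 + (sum (λ u → ⟦ A (punchIn h u) h ⟧) + degreeSum G-h)
        ≡⟨ cong (λ d → 1 + (d + degreeSum G-h)) into-leaf ⟩
      2 + degreeSum G-h
        ∎
      where
      open ≡-Reasoning
      into-leaf : sum (λ u → ⟦ A (punchIn h u) h ⟧) ≡ 1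
      into-leaf = begin
        sum (λ u → ⟦ A (punchIn h u) h ⟧)
          ≡⟨ cong (λ b → ⟦ b ⟧ + sum (λ u → ⟦ A (punchIn h u) h ⟧)) (sym (proj₂ simple h)) ⟩
        ⟦ A h h ⟧ + sum (λ u → ⟦ A (punchIn h u) h ⟧)
          ≡⟨ sym (sum-remove {i = h} λ u → ⟦ A u h ⟧) ⟩
        sum (λ u → ⟦ A u h ⟧)
          ≡⟨ sum-cong-≗ {suc (suc N)} (λ u → cong ⟦_⟧ (symmetric u h)) ⟩
        degree G h
          ≡⟨ degree-leaf ⟩
        1
          ∎

degreeSum-tree : ∀ T → IsTree T → degreeSum T + 2 ≡ 2 * n T
degreeSum-tree record { n = zero }              (_ , () , _)
degreeSum-tree record { n = suc N ; adj = A } = go N A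
  where
  go : ∀ N A → IsTree (record { n = suc N ; adj = A }) →
       degreeSum (record { n = suc N ; adj = A }) + 2 ≡ 2 * suc N
  go zero    A ((_ , irreflexive) , _) = cong (λ b → ⟦ b ⟧ + 0 + 0 + 2) (irreflexive zero)
  go (suc N) A tree with tree-leaf tree {zero} {suc zero} (λ ())
  ... | h , q , leaf = begin
    degreeSum G + 2             ≡⟨ cong (_+ 2) (degreeSum-delete-leaf (proj₁ tree) leaf) ⟩
    2 + degreeSum G-h + 2       ≡⟨ ℕₚ.+-assoc 2 (degreeSum G-h) 2 ⟩
    2 + (degreeSum G-h + 2)     ≡⟨ cong (2 +_) (go N _ (tree-G-h (proj₁ tree) leaf tree)) ⟩
    2 + 2 * suc N               ≡⟨ sym (ℕₚ.*-suc 2 (suc N)) ⟩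
    2 * suc (suc N)             ∎
    where
    open ≡-Reasoning
    open LeafDeletion A h q

module Cons (T : Graph) (k : ℕ) where

  G : Graph
  G = cons T k

  vertex : Fin (n T) → Fin (suc k) → Fin (n G)
  vertex = combine {n T} {suc k}

  block : Fin (n G) → Fin (n T)
  block v = proj₁ (remQuot {n T} (suc k) v)

  position : Fin (n G) → Fin (suc k)
  position v = proj₂ (remQuot {n T} (suc k) v)

  block-vertex : ∀ i a → block (vertex i a) ≡ i
  block-vertex i a = cong proj₁ (Finₚ.remQuot-combine {n T} {suc k} i a)

  position-vertex : ∀ i a → position (vertex i a) ≡ a
  position-vertex i a = cong proj₂ (Finₚ.remQuot-combine {n T} {suc k} i a)

  vertex-block-position : ∀ v → vertex (block v) (position v) ≡ v
  vertex-block-position = Finₚ.combine-remQuot {n T} (suc k)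

  vertex-block : ∀ {v a} → position v ≡ a → vertex (block v) a ≡ v
  vertex-block {v} refl = vertex-block-position v

  block-position-injective : ∀ {u v} → block u ≡ block v → position u ≡ position v → u ≡ v
  block-position-injective {u} {v} bu≡bv pu≡pv =
    trans (sym (vertex-block-position u)) (trans (cong₂ vertex bu≡bv pu≡pv) (vertex-block-position v))

  consAdj : Fin (n T) × Fin (suc k) → Fin (n T) × Fin (suc k) → Bool
  consAdj x y = consBase T k x y ∨ consBase T k y x

  adj-vertex : ∀ i a j b → adj G (vertex i a) (vertex j b) ≡ consAdj (i , a) (j , b)
  adj-vertex i a j b rewrite Finₚ.remQuot-combine {n T} {suc k} i a | Finₚ.remQuot-combine {n T} {suc k} j b = refl

  adj-cycle : ∀ i a → adj G (vertex i (suc a)) (vertex i (suc (next a))) ≡ true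
  adj-cycle i a rewrite adj-vertex i (suc a) i (suc (next a)) | ≡ᵇ-refl i | ≡ᵇ-refl (next a) = refl

  consAdj⇒same-block : ∀ i a j b → Bool.T (consAdj (i , a) (j , suc b)) → i ≡ j
  consAdj⇒same-block i zero j b t with Equivalence.to Boolₚ.T-∨ t
  ... | inj₁ t₁ = T-≡ᵇ⇒≡ (proj₁ (Equivalence.to Boolₚ.T-∧ t₁))
  ... | inj₂ ()
  consAdj⇒same-block i (suc a) j b t with Equivalence.to Boolₚ.T-∨ t
  ... | inj₁ t₁ = T-≡ᵇ⇒≡ (proj₁ (Equivalence.to Boolₚ.T-∧ t₁))
  ... | inj₂ t₂ = sym (T-≡ᵇ⇒≡ (proj₁ (Equivalence.to Boolₚ.T-∧ t₂)))

  adj⇒same-block : ∀ {u v b} → position v ≡ suc b → adj G u v ≡ true → block u ≡ block v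
  adj⇒same-block {u} {v} {b} pv≡b⁺ uv = consAdj⇒same-block (block u) (position u) (block v) b
    (subst (λ p → Bool.T (consAdj (remQuot {n T} (suc k) u) (block v , p))) pv≡b⁺ (Equivalence.from Boolₚ.T-≡ uv))

  blockPair : Fin (n T) → Fin (n T) → ℕ
  blockPair i j = sum λ a → sum λ b → ⟦ consAdj (i , a) (j , b) ⟧

  degreeSum≡∑blockPair : degreeSum G ≡ sum λ i → sum λ j → blockPair i j
  degreeSum≡∑blockPair = begin
    degreeSum G
      ≡⟨ sum-cong-≗ {n G} (λ u → sum-combine (n T) (suc k) (λ v → ⟦ adj G u v ⟧)) ⟩
    sum (λ u → sum {n T} λ j → sum λ b → ⟦ adj G u (vertex j b) ⟧)
      ≡⟨ sum-combine (n T) (suc k) _ ⟩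
    sum {n T} (λ i → sum λ a → sum {n T} λ j → sum λ b → ⟦ adj G (vertex i a) (vertex j b) ⟧)
      ≡⟨ sum-cong-≗ {n T} (λ i → ∑-comm {suc k} {n T} λ a j → sum λ b → ⟦ adj G (vertex i a) (vertex j b) ⟧) ⟩
    sum {n T} (λ i → sum {n T} λ j → sum λ a → sum λ b → ⟦ adj G (vertex i a) (vertex j b) ⟧)
      ≡⟨ sum-cong-≗ {n T} (λ i → sum-cong-≗ {n T} λ j → sum-cong-≗ {suc k} λ a → sum-cong-≗ {suc k} λ b →
                           cong ⟦_⟧ (adj-vertex i a j b)) ⟩
    sum (λ i → sum λ j → blockPair i j)
      ∎
    where open ≡-Reasoning

  ∣D∣≡∑blocks : ∀ D → ∣ D ∣ ≡ sum {n T} λ i → sum {suc k} λ a → ⟦ lookup D (vertex i a) ⟧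
  ∣D∣≡∑blocks D = trans (∣p∣≡sum D) (sum-combine (n T) (suc k) (⟦_⟧ ∘ lookup D))

  treeVertices : Subset (n G)
  treeVertices = Vec.tabulate λ v → does (position v Finₚ.≟ zero)

  lookup-treeVertices : ∀ i a → lookup treeVertices (vertex i a) ≡ does (a Finₚ.≟ zero)
  lookup-treeVertices i a =
    trans (Vecₚ.lookup∘tabulate _ (vertex i a)) (cong (λ b → does (b Finₚ.≟ zero)) (position-vertex i a))

  ∈-treeVertices : ∀ i → vertex i zero ∈ treeVertices
  ∈-treeVertices i =
    Vecₚ.lookup⇒[]= _ treeVertices (trans (lookup-treeVertices i zero) (dec-true (zero {k} Finₚ.≟ zero) refl))

  ∣treeVertices∣ : ∣ treeVertices ∣ ≡ n T
  ∣treeVertices∣ = begin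
    ∣ treeVertices ∣
      ≡⟨ ∣D∣≡∑blocks treeVertices ⟩
    sum {n T} (λ i → sum {suc k} λ a → ⟦ lookup treeVertices (vertex i a) ⟧)
      ≡⟨ sum-cong-≗ {n T} (λ i → sum-cong-≗ {suc k} λ a → cong ⟦_⟧ (lookup-treeVertices i a)) ⟩
    sum {n T} (λ i → sum {suc k} λ a → ⟦ does (a Finₚ.≟ zero) ⟧)
      ≡⟨ sum-cong-≗ {n T} (λ _ → sum-≟ (zero {k})) ⟩
    sum {n T} (λ _ → 1)
      ≡⟨ sum-ones (n T) ⟩
    n T
      ∎
    where open ≡-Reasoning

  isolating⇒meets-block : ∀ D → IsCkIsolating G k D → ∀ i → ∃ λ a → lookup D (vertex i a) ≡ true
  isolating⇒meets-block D isolating i with Finₚ.any? (λ a → lookup D (vertex i a) Boolₚ.≟ true)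
  ... | yes hit = hit
  ... | no miss = ⊥-elim (isolating (cycle , cycle-injective , cycle-avoids , λ a → adj-cycle i a))
    where
    cycle : Fin k → Fin (n G)
    cycle a = vertex i (suc a)
    cycle-injective : Injective _≡_ _≡_ cycle
    cycle-injective = Finₚ.suc-injective ∘ proj₂ ∘ Finₚ.combine-injective i _ i _
    block-outside-D : ∀ {u} → block u ≡ i → lookup D u ≢ true
    block-outside-D {u} bu≡i u∈D =
      miss (position u , subst (λ j → lookup D (vertex j (position u)) ≡ true) bu≡i
                               (subst (λ w → lookup D w ≡ true) (sym (vertex-block-position u)) u∈D))
    cycle-avoids : ∀ a → ¬ InClosedNbhd G D (cycle a)
    cycle-avoids a (inj₁ ∈D)             = block-outside-D (block-vertex i (suc a)) (Vecₚ.[]=⇒lookup ∈D)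
    cycle-avoids a (inj₂ (u , ∈D , adj)) = block-outside-D
      (trans (adj⇒same-block (position-vertex i (suc a)) adj) (block-vertex i (suc a))) (Vecₚ.[]=⇒lookup ∈D)

  isolating⇒n≤∣D∣ : ∀ D → IsCkIsolating G k D → n T ≤ ∣ D ∣
  isolating⇒n≤∣D∣ D isolating = begin
    n T                                                           ≡⟨ sym (sum-ones (n T)) ⟩
    sum {n T} (λ _ → 1)                                           ≤⟨ sum-mono {n T} block-count ⟩
    sum {n T} (λ i → sum {suc k} λ a → ⟦ lookup D (vertex i a) ⟧) ≡⟨ sym (∣D∣≡∑blocks D) ⟩
    ∣ D ∣                                                         ∎
    where
    open ℕₚ.≤-Reasoning
    block-count : ∀ i → 1 ≤ sum {suc k} λ a → ⟦ lookup D (vertex i a) ⟧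
    block-count i =
      let a , hit = isolating⇒meets-block D isolating i
      in  subst (λ b → ⟦ b ⟧ ≤ _) hit (term≤sum (λ a → ⟦ lookup D (vertex i a) ⟧) a)

cons-simple : ∀ {T} m → IsSimple T → IsSimple (cons T (suc (suc m)))
cons-simple {T} m (_ , irreflexive) =
  (λ u v → Boolₚ.∨-comm (consBase T k (rq u) (rq v)) (consBase T k (rq v) (rq u))) ,
  λ v → cong₂ _∨_ (base-irreflexive (rq v)) (base-irreflexive (rq v))
  where
  k = suc (suc m)
  rq : Fin (n T * suc k) → Fin (n T) × Fin (suc k)
  rq = remQuot {n T} (suc k)
  base-irreflexive : ∀ x → consBase T k x x ≡ false
  base-irreflexive (i , zero)  = irreflexive i
  base-irreflexive (i , suc a) rewrite ≡ᵇ-refl i = ≡ᵇ-≢ (next≢id a ∘ sym)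

treeVertices-isolating : ∀ T m → IsCkIsolating (cons T (suc m)) (suc m) (Cons.treeVertices T (suc m))
-- The offsets of the cycle f are injective into the k − 1 positions 2, …, k of a single block.
treeVertices-isolating T m (f , f-injective , f-avoids , f-adjacent) =
  ℕₚ.<-irrefl refl (Finₚ.injective⇒≤ offset-injective)
  where
  open Cons T (suc m)
  adj-hub : ∀ i → adj G (vertex i zero) (vertex i (suc zero)) ≡ true
  adj-hub i rewrite adj-vertex i zero i (suc zero) | ≡ᵇ-refl i = refl
  far : ∀ v → ¬ InClosedNbhd G treeVertices v → ∃ λ b → position v ≡ suc (suc b)
  far v v∉N = by-position (position v) refl
    where
    by-position : ∀ a → position v ≡ a → ∃ λ b → position v ≡ suc (suc b)
    by-position zero pv =
      ⊥-elim (v∉N (inj₁ (subst (_∈ treeVertices) (vertex-block pv) (∈-treeVertices (block v)))))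
    by-position (suc zero) pv =
      ⊥-elim (v∉N (inj₂ (vertex (block v) zero , ∈-treeVertices (block v) ,
                         subst (λ w → adj G (vertex (block v) zero) w ≡ true) (vertex-block pv) (adj-hub (block v)))))
    by-position (suc (suc b)) pv = b , pv
  offset : Fin (suc m) → Fin m
  offset a = proj₁ (far (f a) (f-avoids a))
  position-f : ∀ a → position (f a) ≡ suc (suc (offset a))
  position-f a = proj₂ (far (f a) (f-avoids a))
  block-f : ∀ a → block (f a) ≡ block (f zero)
  block-f = next-invariant⇒constant (block ∘ f) λ a → sym (adj⇒same-block (position-f (next a)) (f-adjacent a))
  offset-injective : Injective _≡_ _≡_ offset
  offset-injective {a} {a′} eq = f-injective (block-position-injective (trans (block-f a) (sym (block-f a′)))
    (trans (position-f a) (trans (cong (λ b → suc (suc b)) eq) (sym (position-f a′)))))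

module _ {T : Graph} (m : ℕ) (simple : IsSimple T) where

  private
    k : ℕ
    k = suc (suc (suc m))
    open Cons T k

    block-arithmetic : ∀ x δ k → (x + δ) + (δ + δ * (k + k)) ≡ x + δ * (2 * suc k)
    block-arithmetic = solve-∀

    symmetric = proj₁ simple
    c = 2 * suc k

    hubs : ∀ i j → ⟦ consAdj (i , zero) (j , zero) ⟧ ≡ ⟦ adj T i j ⟧
    hubs i j = cong ⟦_⟧ (trans (cong (adj T i j ∨_) (symmetric j i)) (Boolₚ.∨-idem _))

    spokes-out : ∀ i j → sum (λ b → ⟦ consAdj (i , zero) (j , suc b) ⟧) ≡ ⟦ does (j Finₚ.≟ i) ⟧
    spokes-out i j with j Finₚ.≟ i
    ... | yes refl rewrite ≡ᵇ-refl i =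
      trans (sum-cong-≗ {k} λ b → cong ⟦_⟧ (Boolₚ.∨-identityʳ (toℕ b ≡ᵇ 0))) (sum-≡ᵇ {k} zero)
    ... | no j≢i   rewrite ≡ᵇ-≢ (j≢i ∘ sym) = sum-zero {k} (λ _ → 0) λ _ → refl

    spokes-in : ∀ i j → sum (λ a → ⟦ consAdj (i , suc a) (j , zero) ⟧) ≡ ⟦ does (j Finₚ.≟ i) ⟧
    spokes-in i j with j Finₚ.≟ i
    ... | yes refl rewrite ≡ᵇ-refl i = sum-≡ᵇ {k} zero
    ... | no j≢i   rewrite ≡ᵇ-≢ j≢i = sum-zero {k} (λ _ → 0) λ _ → refl

    rim : ∀ i j → sum (λ a → sum λ b → ⟦ consAdj (i , suc a) (j , suc b) ⟧) ≡ ⟦ does (j Finₚ.≟ i) ⟧ * (k + k)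
    rim i j with j Finₚ.≟ i
    ... | yes refl rewrite ≡ᵇ-refl i = trans cycle-degreeSum (sym (ℕₚ.*-identityˡ (k + k)))
    ... | no j≢i   rewrite ≡ᵇ-≢ j≢i | ≡ᵇ-≢ (j≢i ∘ sym) =
      sum-zero {k} (λ _ → sum {k} λ _ → 0) λ _ → sum-zero {k} (λ _ → 0) λ _ → refl

  blockPair-formula : ∀ i j → blockPair i j ≡ ⟦ adj T i j ⟧ + ⟦ does (j Finₚ.≟ i) ⟧ * (2 * suc k)
  blockPair-formula i j = begin
    blockPair i j
      ≡⟨ sum₂-split (λ a b → ⟦ consAdj (i , a) (j , b) ⟧) ⟩
    _ ≡⟨ cong₂ _+_ (cong₂ _+_ (hubs i j) (spokes-out i j)) (cong₂ _+_ (spokes-in i j) (rim i j)) ⟩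
    (⟦ adj T i j ⟧ + δ) + (δ + δ * (k + k))
      ≡⟨ block-arithmetic ⟦ adj T i j ⟧ δ k ⟩
    ⟦ adj T i j ⟧ + δ * c
      ∎
    where
    open ≡-Reasoning
    δ = ⟦ does (j Finₚ.≟ i) ⟧

  degreeSum-cons : degreeSum (cons T k) ≡ degreeSum T + n T * (2 * suc k)
  degreeSum-cons = begin
    degreeSum G
      ≡⟨ degreeSum≡∑blockPair ⟩
    sum (λ i → sum λ j → blockPair i j)
      ≡⟨ sum-cong-≗ {n T} (λ i → sum-cong-≗ {n T} (blockPair-formula i)) ⟩
    sum (λ i → sum λ j → ⟦ adj T i j ⟧ + ⟦ does (j Finₚ.≟ i) ⟧ * c)
      ≡⟨ sum-cong-≗ {n T} (λ i → ∑-distrib-+ {n T} (λ j → ⟦ adj T i j ⟧) (λ j → ⟦ does (j Finₚ.≟ i) ⟧ * c)) ⟩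
    sum (λ i → degree T i + sum λ j → ⟦ does (j Finₚ.≟ i) ⟧ * c)
      ≡⟨ sum-cong-≗ {n T} (λ i → cong (degree T i +_) (loops i)) ⟩
    sum (λ i → degree T i + c)
      ≡⟨ ∑-distrib-+ {n T} (degree T) (λ _ → c) ⟩
    degreeSum T + sum {n T} (λ _ → c)
      ≡⟨ cong (degreeSum T +_) (sum-const (n T) c) ⟩
    degreeSum T + n T * c
      ∎
    where
    open ≡-Reasoning
    loops : ∀ i → sum (λ j → ⟦ does (j Finₚ.≟ i) ⟧ * c) ≡ c
    loops i = begin
      sum (λ j → ⟦ does (j Finₚ.≟ i) ⟧ * c)  ≡⟨ sym (*-distribʳ-sum c (λ j → ⟦ does (j Finₚ.≟ i) ⟧)) ⟩
      sum (λ j → ⟦ does (j Finₚ.≟ i) ⟧) * c  ≡⟨ cong (_* c) (sum-≟ i) ⟩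
      1 * c                                  ≡⟨ ℕₚ.*-identityˡ c ⟩
      c                                      ∎

size-cons-arithmetic : ∀ s d N k → 2 * s ≡ d + N * (2 * suc k) → d + 2 ≡ 2 * N → N * (k + 2) ≡ s + 1
size-cons-arithmetic s d N k handshake tree = ℕₚ.*-cancelˡ-≡ (N * (k + 2)) (s + 1) 2 (begin
  2 * (N * (k + 2))              ≡⟨ distribute N k ⟩
  2 * N + N * (2 * suc k)        ≡⟨ cong (_+ N * (2 * suc k)) (sym tree) ⟩
  d + 2 + N * (2 * suc k)        ≡⟨ swap d (N * (2 * suc k)) ⟩
  d + N * (2 * suc k) + 2        ≡⟨ cong (_+ 2) (sym handshake) ⟩
  2 * s + 2                      ≡⟨ sym (ℕₚ.*-distribˡ-+ 2 s 1) ⟩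
  2 * (s + 1)                    ∎)
  where
  open ≡-Reasoning
  distribute : ∀ N k → 2 * (N * (k + 2)) ≡ 2 * N + N * (2 * suc k)
  distribute = solve-∀
  swap : ∀ d x → d + 2 + x ≡ d + x + 2
  swap = solve-∀

proposition1p6 : (k : ℕ) → 3 ≤ k → (G : Graph) → InGk k G →
    Σ ℕ λ c → IotaIs G k c × c * (k + 2) ≡ size G + 1
proposition1p6 k@(suc (suc (suc m))) (s≤s (s≤s (s≤s z≤n))) .(cons T k) (T , tree , refl) =
  n T ,
  ((treeVertices , treeVertices-isolating T (suc (suc m)) , ∣treeVertices∣) , isolating⇒n≤∣D∣) ,
  size-cons-arithmetic (size G) (degreeSum T) (n T) k
    (trans (handshake G (cons-simple (suc m) simple)) (degreeSum-cons m simple))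
    (degreeSum-tree T tree)
  where
  open Cons T k
  simple = proj₁ tree
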